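{- Let $\epsilon=\frac{1}{4\times 17^6\times 48\times 192}$ and let $n$ be an integer. Let $G$ be a chordal graph with $n-\epsilon n$ vertices, and assume $G$ has no clique of size $\epsilon n$. Then there is $Z\subseteq V(G)$ such that $\kappa(Z)\le 2$, and there exist subsets $X_1,X_2,X_3$ of $V(G)\setminus Z$, pairwise disjoint and pairwise anticomplete, with $|X_i|=\lceil\frac{1}{17}n\rceil$ for every $i\in\{1,2,3\}$.
   Context: A graph is chordal if it has no induced cycle of length at least $4$. $\kappa(Z)$ is the minimum number of cliques of $G$ whose union is $Z$. Two sets are anticomplete if there is no edge between them. -}

module Defs where

open import Data.Nat using (ℕ; zero; suc; _+_; _*_; _∸_; _^_; _≤_; _<_)
open import Data.Nat.DivMod using (_/_)
open import Data.Fin using (Fin; toℕ)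
open import Data.Fin.Subset using (Subset; _∈_; _∉_; ∣_∣)
open import Data.Bool using (Bool; true)
open import Data.List using (List; length)
open import Data.List.Relation.Unary.All using (All)
open import Data.List.Relation.Unary.Any using (Any)
open import Data.Product using (Σ; _×_; ∃-syntax)
open import Data.Sum using (_⊎_)
open import Function.Definitions using (Injective)
open import Function.Bundles using (_⇔_)
open import Relation.Binary.PropositionalEquality using (_≡_; _≢_)
open import Relation.Nullary using (¬_)

record Graph (m : ℕ) : Set where
  field
    adj    : Fin m → Fin m → Bool
    sym    : ∀ u v → adj u v ≡ adj v u
    irrefl : ∀ v → adj v v ≢ true

module _ {m : ℕ} (G : Graph m) where
  open Graph G

  Adj : Fin m → Fin m → Set
  Adj u v = adj u v ≡ true

  Next : {k : ℕ} → Fin k → Fin k → Set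
  Next {k} i j = (suc (toℕ i) ≡ toℕ j) ⊎ ((suc (toℕ i) ≡ k) × (toℕ j ≡ 0))

  CycAdj : {k : ℕ} → Fin k → Fin k → Set
  CycAdj i j = Next i j ⊎ Next j i

  InducedCycle : ℕ → Set
  InducedCycle k = Σ (Fin k → Fin m) λ c →
    Injective _≡_ _≡_ c × (∀ i j → Adj (c i) (c j) ⇔ CycAdj i j)

  Chordal : Set
  Chordal = ∀ k → 4 ≤ k → ¬ InducedCycle k

  IsClique : Subset m → Set
  IsClique C = ∀ u v → u ∈ C → v ∈ C → u ≢ v → Adj u v

  -- κ(Z) ≤ k : Z is the union of at most k cliques of G.
  κ≤ : Subset m → ℕ → Set
  κ≤ Z k = Σ (List (Subset m)) λ Cs →
    (length Cs ≤ k) × All IsClique Cs × (∀ v → (v ∈ Z) ⇔ Any (v ∈_) Cs)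

  Anticomplete : Subset m → Subset m → Set
  Anticomplete A B = ∀ u v → u ∈ A → v ∈ B → ¬ Adj u v

Disjoint : {m : ℕ} → Subset m → Subset m → Set
Disjoint A B = ∀ v → v ∈ A → v ∉ B

AvoidsSet : {m : ℕ} → Subset m → Subset m → Set
AvoidsSet X Z = ∀ v → v ∈ X → v ∉ Z

-- ε = 1 / D
D : ℕ
D = 4 * 17 ^ 6 * 48 * 192

ceil17 : ℕ → ℕ
ceil17 n = (n + 16) / 17

-- Let A be a connected set whose neighbourhood N inside the current vertex set W is a clique.
-- In a chordal graph some vertex of A is adjacent to all of N: a vertex v of A missing s ∈ N can
-- be traded for one adjacent to s and to every neighbour of v in N, since otherwise a route
-- through A to s avoiding the other neighbours of some t ∈ N would close with t an induced cycle
-- of length at least 4. Removing such a hub h from A, the clique C = N ∪ {h} separates every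
-- component of A − h from the rest of W. Absorbing these components one by one either collects
-- between θ and θ + M vertices, a set X anticomplete to W − C − X, or meets a component larger
-- than M, on which we recurse. Done twice with θ = M = ⌈n/17⌉, first in V(G) and then in the part
-- Y₁ left over, this gives two cliques and three pairwise anticomplete sets X₁, X₂, Y₂; the bound
-- on clique sizes leaves Y₂ with at least ⌈n/17⌉ vertices.
module Submission where

open import Defs
open import Data.Nat using (ℕ; zero; suc; _+_; _*_; _∸_; _≤_; _<_; z≤n; s≤s; _≤?_; _<?_; NonZero; >-nonZero)
open import Data.Nat.Properties
open import Data.Nat.DivMod using (m/n*n≤m)
open import Data.Nat.Tactic.RingSolver using (solve-∀)
open import Data.Fin using (Fin; toℕ; fromℕ<)
open import Data.Fin.Properties using (any?; toℕ-injective; toℕ<n) renaming (_≟_ to _≟ᶠ_)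
open import Data.Fin.Subset
open import Data.Fin.Subset.Properties
open import Data.Fin.Subset.Induction using (⊃-wellFounded; ⊂-wellFounded; Acc; acc)
open import Data.Bool using (true)
open import Data.Bool.Properties using () renaming (_≟_ to _≟ᵇ_)
open import Data.Vec using (tabulate; []; _∷_; here; there)
open import Data.Vec.Properties using (lookup∘tabulate; []=⇒lookup; lookup⇒[]=)
open import Data.List using (_∷_; [])
open import Data.List.Relation.Unary.All using (_∷_; [])
open import Data.List.Relation.Unary.Any using (Any; here; there)
open import Data.Product using (∃; Σ; _×_; _,_; proj₁; proj₂)
open import Data.Sum using (_⊎_; inj₁; inj₂; swap; [_,_]′)
open import Data.Empty using (⊥-elim)
open import Function using (_∘_)
open import Function.Bundles using (_⇔_; mk⇔; Equivalence)
open import Level using (0ℓ)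
open import Relation.Binary using (tri<; tri≈; tri>)
open import Relation.Binary.PropositionalEquality
open import Relation.Nullary using (¬_; Dec; does; yes; no; contradiction)
open import Relation.Nullary.Decidable using (dec-true; ¬?; _×-dec_; _⊎-dec_; decidable-stable)
open import Relation.Unary using (Pred; Decidable)

private
  variable
    n : ℕ

select : {P : Pred (Fin n) 0ℓ} → Decidable P → Subset n
select P? = tabulate (λ x → does (P? x))

∈-select⁺ : {P : Pred (Fin n) 0ℓ} (P? : Decidable P) {x : Fin n} → P x → x ∈ select P?
∈-select⁺ P? {x} px = lookup⇒[]= x _ (trans (lookup∘tabulate _ x) (dec-true (P? x) px))

∈-select⁻ : {P : Pred (Fin n) 0ℓ} (P? : Decidable P) {x : Fin n} → x ∈ select P? → P x
∈-select⁻ P? {x} x∈ with P? x | trans (sym (lookup∘tabulate _ x)) ([]=⇒lookup x∈)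
... | yes px | _ = px
... | no _   | ()

∣p∪q∣≤∣p∣+∣q∣ : ∀ (p q : Subset n) → ∣ p ∪ q ∣ ≤ ∣ p ∣ + ∣ q ∣
∣p∪q∣≤∣p∣+∣q∣ [] [] = z≤n
∣p∪q∣≤∣p∣+∣q∣ (inside ∷ p) (inside ∷ q) =
  s≤s (≤-trans (∣p∪q∣≤∣p∣+∣q∣ p q) (+-monoʳ-≤ ∣ p ∣ (n≤1+n ∣ q ∣)))
∣p∪q∣≤∣p∣+∣q∣ (inside ∷ p) (outside ∷ q) = s≤s (∣p∪q∣≤∣p∣+∣q∣ p q)
∣p∪q∣≤∣p∣+∣q∣ (outside ∷ p) (inside ∷ q) rewrite +-suc ∣ p ∣ ∣ q ∣ = s≤s (∣p∪q∣≤∣p∣+∣q∣ p q)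
∣p∪q∣≤∣p∣+∣q∣ (outside ∷ p) (outside ∷ q) = ∣p∪q∣≤∣p∣+∣q∣ p q

p⊆q∪p─q : ∀ (p q : Subset n) → p ⊆ q ∪ (p ─ q)
p⊆q∪p─q p q {x} x∈p with x ∈? q
... | yes x∈q = p⊆p∪q (p ─ q) x∈q
... | no  x∉q = q⊆p∪q q (p ─ q) (x∈p∧x∉q⇒x∈p─q x∈p x∉q)

∣p∣≤∣q∣+∣p─q∣ : ∀ (p q : Subset n) → ∣ p ∣ ≤ ∣ q ∣ + ∣ p ─ q ∣
∣p∣≤∣q∣+∣p─q∣ p q = ≤-trans (p⊆q⇒∣p∣≤∣q∣ (p⊆q∪p─q p q)) (∣p∪q∣≤∣p∣+∣q∣ q (p ─ q))

∣q∣<∣p∣⇒∃p─q : ∀ {p q : Subset n} → ∣ q ∣ < ∣ p ∣ → ∃ λ x → x ∈ p × x ∉ q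
∣q∣<∣p∣⇒∃p─q {p = p} {q = q} ∣q∣<∣p∣ with any? (λ x → x ∈? p ×-dec ¬? (x ∈? q))
... | yes found = found
... | no none = contradiction (p⊆q⇒∣p∣≤∣q∣ p⊆q) (<⇒≱ ∣q∣<∣p∣)
  where
  p⊆q : p ⊆ q
  p⊆q {x} x∈p = decidable-stable (x ∈? q) (λ x∉q → none (x , x∈p , x∉q))

∃-subset-of-size : ∀ {k} (p : Subset n) → k ≤ ∣ p ∣ → ∃ λ q → q ⊆ p × ∣ q ∣ ≡ k
∃-subset-of-size {n} {zero} p _ = ⊥ , ⊥⊆ , ∣⊥∣≡0 n
∃-subset-of-size (outside ∷ p) k≤ with ∃-subset-of-size p k≤
... | q , q⊆p , ∣q∣≡k = outside ∷ q , out⊆ q⊆p , ∣q∣≡k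
∃-subset-of-size {k = suc k} (inside ∷ p) (s≤s k≤) with ∃-subset-of-size p k≤
... | q , q⊆p , ∣q∣≡k = inside ∷ q , in⊆in q⊆p , cong suc ∣q∣≡k

x∈p─q⇒x∉q : ∀ {x} (p q : Subset n) → x ∈ p ─ q → x ∉ q
x∈p─q⇒x∉q (inside ∷ p) (outside ∷ q) here ()
x∈p─q⇒x∉q (_ ∷ p) (_ ∷ q) (there x∈p─q) (there x∈q) = x∈p─q⇒x∉q p q x∈p─q x∈q

∣p∣>0⇒Nonempty : ∀ {p : Subset n} → 0 < ∣ p ∣ → Nonempty p
∣p∣>0⇒Nonempty {n} {p} 0<∣p∣ with ∣q∣<∣p∣⇒∃p─q {q = ⊥} (subst (_< ∣ p ∣) (sym (∣⊥∣≡0 n)) 0<∣p∣)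
... | x , x∈p , _ = x , x∈p

greatest-≤ : {P : Pred ℕ 0ℓ} → Decidable P → ∀ L → P 0 →
  ∃ λ o → o ≤ L × P o × (∀ j → o < j → j ≤ L → ¬ P j)
greatest-≤ P? zero p0 = 0 , z≤n , p0 , λ j 0<j j≤0 _ → <⇒≱ 0<j j≤0
greatest-≤ {P} P? (suc L) p0 with P? (suc L)
... | yes pL = suc L , ≤-refl , pL , λ j L<j j≤L _ → <⇒≱ L<j j≤L
... | no ¬pL with greatest-≤ P? L p0
...   | o , o≤L , po , after = o , m≤n⇒m≤1+n o≤L , po , after′
  where
  after′ : ∀ j → o < j → j ≤ suc L → ¬ P j
  after′ j o<j j≤1+L with m≤n⇒m<n∨m≡n j≤1+L
  ... | inj₁ j<1+L = after j o<j (≤-pred j<1+L)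
  ... | inj₂ refl  = ¬pL

-- `CycAdj G {k} i j` of Defs unfolds to `CycAdjMod k (toℕ i) (toℕ j)`.
NextMod : ℕ → ℕ → ℕ → Set
NextMod k p q = (suc p ≡ q) ⊎ ((suc p ≡ k) × (q ≡ 0))

CycAdjMod : ℕ → ℕ → ℕ → Set
CycAdjMod k p q = NextMod k p q ⊎ NextMod k q p

module _ {m : ℕ} (G : Graph m) where

  private
    variable
      a b s t u v w x y z : Fin m
      P Q : Pred (Fin m) 0ℓ

  Adj-sym : Adj G x y → Adj G y x
  Adj-sym {x} {y} xy = trans (Graph.sym G y x) xy

  Adj⇒≢ : Adj G x y → x ≢ y
  Adj⇒≢ {x} xy refl = Graph.irrefl G x xy

  Adj? : ∀ x y → Dec (Adj G x y)
  Adj? x y = Graph.adj G x y ≟ᵇ true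

  Far : Fin m → Pred (Fin m) 0ℓ
  Far x v = v ≢ x × ¬ Adj G x v

  neighbours : Fin m → Subset m
  neighbours v = select (Adj? v)

  infixr 5 _∷⟨_⟩_
  infixl 5 _∷ʳ⟨_⟩_

  data Walk (P : Pred (Fin m) 0ℓ) : Fin m → Fin m → Set where
    [_]    : P x → Walk P x x
    _∷⟨_⟩_ : P x → Adj G x y → Walk P y z → Walk P x z

  Walk-head : Walk P x y → P x
  Walk-head [ px ]         = px
  Walk-head (px ∷⟨ _ ⟩ _) = px

  Walk-map : (∀ {v} → P v → Q v) → Walk P x y → Walk Q x y
  Walk-map f [ px ]           = [ f px ]
  Walk-map f (px ∷⟨ xy ⟩ xs) = f px ∷⟨ xy ⟩ Walk-map f xs

  _∷ʳ⟨_⟩_ : Walk P x y → Adj G y z → P z → Walk P x z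
  [ px ]           ∷ʳ⟨ yz ⟩ pz = px ∷⟨ yz ⟩ [ pz ]
  (px ∷⟨ xy ⟩ xs) ∷ʳ⟨ yz ⟩ pz = px ∷⟨ xy ⟩ (xs ∷ʳ⟨ yz ⟩ pz)

  first-hit : Decidable Q → Walk P x y → Q y →
    ∃ λ w → Q w × P w × Walk (λ v → v ≡ w ⊎ (P v × ¬ Q v)) x w
  first-hit {x = x} Q? [ px ] qx = x , qx , px , [ inj₁ refl ]
  first-hit {x = x} Q? (px ∷⟨ xy ⟩ xs) qy with Q? x
  ... | yes qx = x , qx , px , [ inj₁ refl ]
  ... | no ¬qx with first-hit Q? xs qy
  ...   | w , qw , pw , ys = w , qw , pw , inj₂ (px , ¬qx) ∷⟨ xy ⟩ ys

  avoids-or-last-hit : Decidable Q → Walk P x y →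
    Walk (λ v → P v × ¬ Q v) x y ⊎ ∃ λ u → Q u × P u × Walk (λ v → v ≡ u ⊎ (P v × ¬ Q v)) u y
  avoids-or-last-hit {x = x} Q? [ px ] with Q? x
  ... | yes qx = inj₂ (x , qx , px , [ inj₁ refl ])
  ... | no ¬qx = inj₁ [ px , ¬qx ]
  avoids-or-last-hit {x = x} Q? (px ∷⟨ xy ⟩ xs) with avoids-or-last-hit Q? xs
  ... | inj₂ hit = inj₂ hit
  ... | inj₁ ys with Q? x
  ...   | yes qx = inj₂ (x , qx , px , inj₁ refl ∷⟨ xy ⟩ Walk-map inj₂ ys)
  ...   | no ¬qx = inj₁ ((px , ¬qx) ∷⟨ xy ⟩ ys)

  last-hit : Decidable Q → Walk P x y → Q x →
    ∃ λ u → Q u × P u × Walk (λ v → v ≡ u ⊎ (P v × ¬ Q v)) u y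
  last-hit Q? xs qx with avoids-or-last-hit Q? xs
  ... | inj₁ ys  = contradiction qx (proj₂ (Walk-head ys))
  ... | inj₂ hit = hit

  Connected : Subset m → Set
  Connected A = ∀ {x y} → x ∈ A → y ∈ A → Walk (_∈ A) x y

  Connected-⁅⁆ : Connected ⁅ u ⁆
  Connected-⁅⁆ {u} a∈ b∈ rewrite x∈⁅y⁆⇒x≡y u a∈ | x∈⁅y⁆⇒x≡y u b∈ = [ x∈⁅x⁆ u ]

  Connected-∪⁅⁆ : ∀ {K} → Connected K → x ∈ K → Adj G x y → Connected (K ∪ ⁅ y ⁆)
  Connected-∪⁅⁆ {x} {y} {K} K-connected x∈K x∼y {a} {b} a∈ b∈
    with x∈p∪q⁻ K ⁅ y ⁆ a∈ | x∈p∪q⁻ K ⁅ y ⁆ b∈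
  ... | inj₁ a∈K | inj₁ b∈K = Walk-map (p⊆p∪q _) (K-connected a∈K b∈K)
  ... | inj₁ a∈K | inj₂ b∈y rewrite x∈⁅y⁆⇒x≡y y b∈y =
    Walk-map (p⊆p∪q _) (K-connected a∈K x∈K) ∷ʳ⟨ x∼y ⟩ q⊆p∪q K ⁅ y ⁆ (x∈⁅x⁆ y)
  ... | inj₂ a∈y | inj₁ b∈K rewrite x∈⁅y⁆⇒x≡y y a∈y =
    q⊆p∪q K ⁅ y ⁆ (x∈⁅x⁆ y) ∷⟨ Adj-sym x∼y ⟩ Walk-map (p⊆p∪q _) (K-connected x∈K b∈K)
  ... | inj₂ a∈y | inj₂ b∈y rewrite x∈⁅y⁆⇒x≡y y a∈y | x∈⁅y⁆⇒x≡y y b∈y = [ q⊆p∪q K ⁅ y ⁆ (x∈⁅x⁆ y) ]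

  -- No edge leaves K inside U: K is a union of components of G[U].
  Closed : Subset m → Subset m → Set
  Closed K U = ∀ {x y} → x ∈ K → y ∈ U → Adj G x y → y ∈ K

  Closed-∪ : ∀ {X K U} → Closed X U → Closed K U → Closed (X ∪ K) U
  Closed-∪ {X} {K} X-closed K-closed x∈X∪K y∈U x∼y with x∈p∪q⁻ X K x∈X∪K
  ... | inj₁ x∈X = p⊆p∪q K (X-closed x∈X y∈U x∼y)
  ... | inj₂ x∈K = q⊆p∪q X K (K-closed x∈K y∈U x∼y)

  Closed-─ : ∀ {X K U} → Closed X U → K ⊆ U ─ X → Closed K (U ─ X) → Closed K U
  Closed-─ {X} {K} {U} X-closed K⊆U─X K-closed {x} {y} x∈K y∈U x∼y with y ∈? X
  ... | yes y∈X =
    contradiction (X-closed y∈X (p─q⊆p U X (K⊆U─X x∈K)) (Adj-sym x∼y)) (x∈p─q⇒x∉q U X (K⊆U─X x∈K))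
  ... | no  y∉X = K-closed x∈K (x∈p∧x∉q⇒x∈p─q y∈U y∉X) x∼y

  record Component (U : Subset m) : Set where
    field
      set       : Subset m
      ⊆U        : set ⊆ U
      connected : Connected set
      closed    : Closed set U

  component : ∀ {U u} → u ∈ U → Σ (Component U) λ K → u ∈ Component.set K
  component {U} {u} u∈U = grow ⁅ u ⁆ (⊃-wellFounded _) (x∈⁅x⁆ u) ⁅u⁆⊆U Connected-⁅⁆
    where
    ⁅u⁆⊆U : ⁅ u ⁆ ⊆ U
    ⁅u⁆⊆U x∈ rewrite x∈⁅y⁆⇒x≡y u x∈ = u∈U

    grow : ∀ K → Acc _⊃_ K → u ∈ K → K ⊆ U → Connected K → Σ (Component U) λ K → u ∈ Component.set K
    grow K (acc rec) u∈K K⊆U K-connected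
      with any? (λ y → y ∈? U ×-dec ¬? (y ∈? K) ×-dec any? (λ x → x ∈? K ×-dec Adj? x y))
    ... | no none = record { set = K ; ⊆U = K⊆U ; connected = K-connected ; closed = K-closed } , u∈K
      where
      K-closed : Closed K U
      K-closed {x} {y} x∈K y∈U x∼y = decidable-stable (y ∈? K) λ y∉K → none (y , y∈U , y∉K , x , x∈K , x∼y)
    ... | yes (y , y∈U , y∉K , x , x∈K , x∼y) =
      grow (K ∪ ⁅ y ⁆) (rec (p⊆p∪q _ , y , q⊆p∪q K ⁅ y ⁆ (x∈⁅x⁆ y) , y∉K)) (p⊆p∪q _ u∈K)
           K∪y⊆U (Connected-∪⁅⁆ K-connected x∈K x∼y)
      where
      K∪y⊆U : K ∪ ⁅ y ⁆ ⊆ U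
      K∪y⊆U z∈ with x∈p∪q⁻ K ⁅ y ⁆ z∈
      ... | inj₁ z∈K = K⊆U z∈K
      ... | inj₂ z∈y rewrite x∈⁅y⁆⇒x≡y y z∈y = y∈U

  record Chunk (U : Subset m) (θ M : ℕ) : Set where
    field
      set    : Subset m
      ⊆U     : set ⊆ U
      closed : Closed set U
      lower  : θ ≤ ∣ set ∣
      upper  : ∣ set ∣ ≤ θ + M

  LargeComponent : Subset m → ℕ → Set
  LargeComponent U M = Σ (Component U) λ K → M < ∣ Component.set K ∣

  chunk-or-large-component : ∀ U θ M → θ ≤ ∣ U ∣ → Chunk U θ M ⊎ LargeComponent U M
  chunk-or-large-component U θ M θ≤∣U∣ =
    grow ⊥ (⊃-wellFounded _) ⊥⊆ (λ x∈⊥ → contradiction x∈⊥ ∉⊥) (subst (_≤ θ + M) (sym (∣⊥∣≡0 m)) z≤n)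
    where
    grow : ∀ X → Acc _⊃_ X → X ⊆ U → Closed X U → ∣ X ∣ ≤ θ + M → Chunk U θ M ⊎ LargeComponent U M
    grow X (acc rec) X⊆U X-closed ∣X∣≤ with θ ≤? ∣ X ∣
    ... | yes θ≤∣X∣ = inj₁ record { set = X ; ⊆U = X⊆U ; closed = X-closed ; lower = θ≤∣X∣ ; upper = ∣X∣≤ }
    ... | no  θ≰∣X∣ with ∣q∣<∣p∣⇒∃p─q (<-≤-trans (≰⇒> θ≰∣X∣) θ≤∣U∣)
    ...   | u , u∈U , u∉X with component (x∈p∧x∉q⇒x∈p─q u∈U u∉X)
    ...     | K , u∈K = absorb (M <? ∣ K.set ∣)
      where
      module K = Component K

      K-closed : Closed K.set U
      K-closed = Closed-─ X-closed K.⊆U K.closed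

      absorb : Dec (M < ∣ K.set ∣) → Chunk U θ M ⊎ LargeComponent U M
      absorb (yes large) = inj₂ (record { set = K.set ; ⊆U = λ x∈K → p─q⊆p U X (K.⊆U x∈K)
                                        ; connected = K.connected ; closed = K-closed } , large)
      absorb (no small) = grow (X ∪ K.set) (rec (p⊆p∪q _ , u , q⊆p∪q X K.set u∈K , u∉X))
                            X∪K⊆U (Closed-∪ X-closed K-closed) ∣X∪K∣≤
        where
        X∪K⊆U : X ∪ K.set ⊆ U
        X∪K⊆U x∈ with x∈p∪q⁻ X K.set x∈
        ... | inj₁ x∈X = X⊆U x∈X
        ... | inj₂ x∈K = p─q⊆p U X (K.⊆U x∈K)
        ∣X∪K∣≤ : ∣ X ∪ K.set ∣ ≤ θ + M
        ∣X∪K∣≤ = ≤-trans (∣p∪q∣≤∣p∣+∣q∣ X K.set) (+-mono-≤ (<⇒≤ (≰⇒> θ≰∣X∣)) (≮⇒≥ small))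

  IsClique-⊥ : IsClique G ⊥
  IsClique-⊥ _ _ u∈⊥ = contradiction u∈⊥ ∉⊥

  IsClique-⁅⁆ : IsClique G ⁅ v ⁆
  IsClique-⁅⁆ {v} u w u∈ w∈ u≢w = contradiction (trans (x∈⁅y⁆⇒x≡y v u∈) (sym (x∈⁅y⁆⇒x≡y v w∈))) u≢w

  IsClique-⊆ : ∀ {C D} → D ⊆ C → IsClique G C → IsClique G D
  IsClique-⊆ D⊆C C-clique u v u∈D v∈D = C-clique u v (D⊆C u∈D) (D⊆C v∈D)

  IsClique-∪⁅⁆ : ∀ {C v} → IsClique G C → (∀ {s} → s ∈ C → Adj G v s) → IsClique G (C ∪ ⁅ v ⁆)
  IsClique-∪⁅⁆ {C} {v} C-clique v-complete s t s∈ t∈ s≢t with x∈p∪q⁻ C ⁅ v ⁆ s∈ | x∈p∪q⁻ C ⁅ v ⁆ t∈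
  ... | inj₁ s∈C | inj₁ t∈C = C-clique s t s∈C t∈C s≢t
  ... | inj₁ s∈C | inj₂ t∈v rewrite x∈⁅y⁆⇒x≡y v t∈v = Adj-sym (v-complete s∈C)
  ... | inj₂ s∈v | inj₁ t∈C rewrite x∈⁅y⁆⇒x≡y v s∈v = v-complete t∈C
  ... | inj₂ s∈v | inj₂ t∈v = contradiction (trans (x∈⁅y⁆⇒x≡y v s∈v) (sym (x∈⁅y⁆⇒x≡y v t∈v))) s≢t

  κ≤-∪ : ∀ {C₁ C₂} → IsClique G C₁ → IsClique G C₂ → κ≤ G (C₁ ∪ C₂) 2
  κ≤-∪ {C₁} {C₂} C₁-clique C₂-clique = C₁ ∷ C₂ ∷ [] , ≤-refl , C₁-clique ∷ C₂-clique ∷ [] , λ _ → mk⇔ to from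
    where
    to : ∀ {v} → v ∈ C₁ ∪ C₂ → Any (v ∈_) (C₁ ∷ C₂ ∷ [])
    to v∈ with x∈p∪q⁻ C₁ C₂ v∈
    ... | inj₁ v∈C₁ = here v∈C₁
    ... | inj₂ v∈C₂ = there (here v∈C₂)
    from : ∀ {v} → Any (v ∈_) (C₁ ∷ C₂ ∷ []) → v ∈ C₁ ∪ C₂
    from (here v∈C₁)         = p⊆p∪q C₂ v∈C₁
    from (there (here v∈C₂)) = q⊆p∪q C₁ C₂ v∈C₂

  InNeighbourhood : Subset m → Subset m → Pred (Fin m) 0ℓ
  InNeighbourhood W A y = y ∈ W × y ∉ A × ∃ λ x → x ∈ A × Adj G x y

  inNeighbourhood? : ∀ W A → Decidable (InNeighbourhood W A)
  inNeighbourhood? W A y = y ∈? W ×-dec ¬? (y ∈? A) ×-dec any? (λ x → x ∈? A ×-dec Adj? x y)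

  neighbourhood : Subset m → Subset m → Subset m
  neighbourhood W A = select (inNeighbourhood? W A)

  ∈-neighbourhood⁺ : ∀ {W A} → InNeighbourhood W A y → y ∈ neighbourhood W A
  ∈-neighbourhood⁺ {W = W} {A} = ∈-select⁺ (inNeighbourhood? W A)

  ∈-neighbourhood⁻ : ∀ {W A} → y ∈ neighbourhood W A → InNeighbourhood W A y
  ∈-neighbourhood⁻ {W = W} {A} = ∈-select⁻ (inNeighbourhood? W A)

  record Separation (W : Subset m) (θ M : ℕ) : Set where
    field
      C X      : Subset m
      C-clique : IsClique G C
      C⊆W      : C ⊆ W
      X⊆W─C    : X ⊆ W ─ C
      X-closed : Closed X (W ─ C)
      lower    : θ ≤ ∣ X ∣
      upper    : ∣ X ∣ ≤ θ + M

    Y : Subset m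
    Y = W ─ C ─ X

    X⊆W : X ⊆ W
    X⊆W x∈X = p─q⊆p W C (X⊆W─C x∈X)

    X∉C : x ∈ X → x ∉ C
    X∉C x∈X = x∈p─q⇒x∉q W C (X⊆W─C x∈X)

    Y⊆W─C : Y ⊆ W ─ C
    Y⊆W─C = p─q⊆p (W ─ C) X

    Y⊆W : Y ⊆ W
    Y⊆W y∈Y = p─q⊆p W C (Y⊆W─C y∈Y)

    Y∉C : y ∈ Y → y ∉ C
    Y∉C y∈Y = x∈p─q⇒x∉q W C (Y⊆W─C y∈Y)

    Y∉X : y ∈ Y → y ∉ X
    Y∉X = x∈p─q⇒x∉q (W ─ C) X

    X-Y-anticomplete : Anticomplete G X Y
    X-Y-anticomplete _ _ x∈X y∈Y x∼y = Y∉X y∈Y (X-closed x∈X (Y⊆W─C y∈Y) x∼y)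

    ∣Y∣-lower : ∀ {k} → ∣ C ∣ + (θ + M) + k ≤ ∣ W ∣ → k ≤ ∣ Y ∣
    ∣Y∣-lower {k} k-room = +-cancelˡ-≤ (∣ C ∣ + (θ + M)) k (∣ Y ∣) (begin
      (∣ C ∣ + (θ + M) + k)      ≤⟨ k-room ⟩
      (∣ W ∣)                    ≤⟨ ∣p∣≤∣q∣+∣p─q∣ W C ⟩
      (∣ C ∣ + ∣ W ─ C ∣)        ≤⟨ +-monoʳ-≤ (∣ C ∣) (∣p∣≤∣q∣+∣p─q∣ (W ─ C) X) ⟩
      (∣ C ∣ + (∣ X ∣ + ∣ Y ∣))  ≤⟨ +-monoʳ-≤ (∣ C ∣) (+-monoˡ-≤ (∣ Y ∣) upper) ⟩
      (∣ C ∣ + (θ + M + ∣ Y ∣))  ≡⟨ +-assoc (∣ C ∣) (θ + M) (∣ Y ∣) ⟨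
      (∣ C ∣ + (θ + M) + ∣ Y ∣)  ∎)
      where open ≤-Reasoning

  IsWalk : (ℕ → Fin m) → ℕ → Set
  IsWalk f L = ∀ i → i < L → Adj G (f i) (f (suc i))

  IsChordless : (ℕ → Fin m) → ℕ → Set
  IsChordless f L = ∀ i j → i < j → j ≤ L → f i ≢ f j × (Adj G (f i) (f j) → j ≡ suc i)

  record InducedPath (P : Pred (Fin m) 0ℓ) (x y : Fin m) : Set where
    field
      len        : ℕ
      vertex     : ℕ → Fin m
      vertex-0   : vertex 0 ≡ x
      vertex-len : vertex len ≡ y
      isWalk     : IsWalk vertex len
      chordless  : IsChordless vertex len
      within     : ∀ j → j ≤ len → P (vertex j)

  open InducedPath

  InducedPath-drop : (π : InducedPath P x y) → ∀ o → o ≤ len π → InducedPath P (vertex π o) y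
  InducedPath-drop π o o≤len = record
    { len        = len π ∸ o
    ; vertex     = λ j → vertex π (j + o)
    ; vertex-0   = refl
    ; vertex-len = trans (cong (vertex π) (m∸n+n≡m o≤len)) (vertex-len π)
    ; isWalk     = λ i i< → isWalk π (i + o) (m≤o∸n⇒m+n≤o (suc i) o≤len i<)
    ; chordless  = λ i j i<j j≤ →
        let (≢ , adj⇒) = chordless π (i + o) (j + o) (+-monoˡ-< o i<j) (m≤o∸n⇒m+n≤o j o≤len j≤)
        in ≢ , λ a → +-cancelʳ-≡ o j (suc i) (adj⇒ a)
    ; within     = λ j j≤ → within π (j + o) (m≤o∸n⇒m+n≤o j o≤len j≤)
    }

  InducedPath-cons : P x → Adj G x y → (π : InducedPath P y z) →
    (∀ j → 0 < j → j ≤ len π → Far x (vertex π j)) → InducedPath P x z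
  InducedPath-cons {P = P} {x = x} px xy π far = record
    { len        = suc (len π)
    ; vertex     = vertex′
    ; vertex-0   = refl
    ; vertex-len = vertex-len π
    ; isWalk     = isWalk′
    ; chordless  = chordless′
    ; within     = within′
    }
    where
    vertex′ : ℕ → Fin m
    vertex′ zero    = x
    vertex′ (suc j) = vertex π j

    x∼π₀ : Adj G x (vertex π 0)
    x∼π₀ = subst (Adj G x) (sym (vertex-0 π)) xy

    isWalk′ : IsWalk vertex′ (suc (len π))
    isWalk′ zero    _         = x∼π₀
    isWalk′ (suc i) (s≤s i<L) = isWalk π i i<L

    chordless′ : IsChordless vertex′ (suc (len π))
    chordless′ zero (suc zero) _ _ = Adj⇒≢ x∼π₀ , λ _ → refl
    chordless′ zero (suc (suc j)) _ (s≤s j<L) =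
      let (≢x , x≁) = far (suc j) (s≤s z≤n) j<L in ≢-sym ≢x , λ x∼ → contradiction x∼ x≁
    chordless′ (suc i) (suc j) (s≤s i<j) (s≤s j≤L) =
      let (≢ , adj⇒) = chordless π i j i<j j≤L in ≢ , λ a → cong suc (adj⇒ a)

    within′ : ∀ j → j ≤ suc (len π) → P (vertex′ j)
    within′ zero    _         = px
    within′ (suc j) (s≤s j≤L) = within π j j≤L

  walk⇒induced-path : Walk P x y → InducedPath P x y
  walk⇒induced-path {x = x} [ px ] = record
    { len = 0 ; vertex = λ _ → x ; vertex-0 = refl ; vertex-len = refl
    ; isWalk = λ _ ()
    ; chordless = λ i j i<j j≤0 → contradiction (≤-trans i<j j≤0) λ ()
    ; within = λ _ _ → px
    }
  walk⇒induced-path {P = P} {x = x} {z} (_∷⟨_⟩_ {y = y} px xy xs) = cut (greatest-≤ near? (len π) near₀)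
    where
    π : InducedPath P y z
    π = walk⇒induced-path xs

    Near : ℕ → Set
    Near j = x ≡ vertex π j ⊎ Adj G x (vertex π j)

    near? : Decidable Near
    near? j = (x ≟ᶠ vertex π j) ⊎-dec Adj? x (vertex π j)

    near₀ : Near 0
    near₀ = inj₂ (subst (Adj G x) (sym (vertex-0 π)) xy)

    -- x is joined to the last vertex of π that it equals or is adjacent to.
    cut : (∃ λ o → o ≤ len π × Near o × (∀ j → o < j → j ≤ len π → ¬ Near j)) → InducedPath P x z
    cut (o , o≤L , inj₁ x≡πₒ , _) = subst (λ v → InducedPath P v z) (sym x≡πₒ) (InducedPath-drop π o o≤L)
    cut (o , o≤L , inj₂ x∼πₒ , after) = InducedPath-cons px x∼πₒ (InducedPath-drop π o o≤L) far
      where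
      far : ∀ j → 0 < j → j ≤ len π ∸ o → Far x (vertex π (j + o))
      far j 0<j j≤ = (λ e → not-near (inj₁ (sym e))) , (λ a → not-near (inj₂ a))
        where
        not-near : ¬ Near (j + o)
        not-near = after (j + o) (m<n+m o 0<j) (m≤o∸n⇒m+n≤o j o≤L j≤)

  module _ {P : Pred (Fin m) 0ℓ} {a b x : Fin m} (π : InducedPath P a b) (x∼a : Adj G x a) (x∼b : Adj G x b)
           (interior-far : ∀ j → 0 < j → j < len π → Far x (vertex π j)) where

    private
      M : ℕ
      M = len π

      g : ℕ → Fin m
      g = vertex π

      cycle : ℕ → Fin m
      cycle j with j ≤? M
      ... | yes _ = g j
      ... | no  _ = x

      cycle-path : ∀ {j} → j ≤ M → cycle j ≡ g j
      cycle-path {j} j≤M with j ≤? M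
      ... | yes _   = refl
      ... | no  j≰M = contradiction j≤M j≰M

      cycle-apex : cycle (suc M) ≡ x
      cycle-apex with suc M ≤? M
      ... | yes M<M = contradiction M<M (n≮n M)
      ... | no  _   = refl

      data View : ℕ → Set where
        path : ∀ {j} → j ≤ M → View j
        apex : View (suc M)

      view : ∀ {j} → j < 2 + M → View j
      view (s≤s j≤1+M) with m≤n⇒m<n∨m≡n j≤1+M
      ... | inj₁ (s≤s j≤M) = path j≤M
      ... | inj₂ refl      = apex

      x∼g : ∀ {j} → j ≤ M → Adj G x (g j) ⇔ (j ≡ 0 ⊎ j ≡ M)
      x∼g {zero} _ = mk⇔ (λ _ → inj₁ refl) (λ _ → subst (Adj G x) (sym (vertex-0 π)) x∼a)
      x∼g {suc j} j<M = mk⇔ to from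
        where
        to : Adj G x (g (suc j)) → suc j ≡ 0 ⊎ suc j ≡ M
        to x∼ with m≤n⇒m<n∨m≡n j<M
        ... | inj₁ 1+j<M = contradiction x∼ (proj₂ (interior-far (suc j) (s≤s z≤n) 1+j<M))
        ... | inj₂ 1+j≡M = inj₂ 1+j≡M
        from : suc j ≡ 0 ⊎ suc j ≡ M → Adj G x (g (suc j))
        from (inj₂ refl) = subst (Adj G x) (sym (vertex-len π)) x∼b

      g≢x : ∀ {j} → j ≤ M → g j ≢ x
      g≢x {zero} _ g≡x = Adj⇒≢ (Equivalence.from (x∼g z≤n) (inj₁ refl)) (sym g≡x)
      g≢x {suc j} j<M with m≤n⇒m<n∨m≡n j<M
      ... | inj₁ 1+j<M = proj₁ (interior-far (suc j) (s≤s z≤n) 1+j<M)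
      ... | inj₂ 1+j≡M = λ g≡x → Adj⇒≢ (Equivalence.from (x∼g j<M) (inj₂ 1+j≡M)) (sym g≡x)

      not-last : ∀ {p} → p ≤ M → suc p ≢ 2 + M
      not-last p≤M 1+p≡ = <⇒≢ (s≤s p≤M) (suc-injective 1+p≡)

      apex-cyc⇔ : ∀ {p} → p ≤ M → CycAdjMod (2 + M) p (suc M) ⇔ (p ≡ 0 ⊎ p ≡ M)
      apex-cyc⇔ {p} p≤M = mk⇔ to from
        where
        to : CycAdjMod (2 + M) p (suc M) → p ≡ 0 ⊎ p ≡ M
        to (inj₁ (inj₁ 1+p≡1+M))     = inj₂ (suc-injective 1+p≡1+M)
        to (inj₁ (inj₂ (1+p≡ , _)))  = contradiction 1+p≡ (not-last p≤M)
        to (inj₂ (inj₁ 2+M≡p))       = contradiction (sym 2+M≡p) (<⇒≢ (≤-trans (s≤s p≤M) (n≤1+n _)))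
        to (inj₂ (inj₂ (_ , p≡0)))   = inj₁ p≡0
        from : p ≡ 0 ⊎ p ≡ M → CycAdjMod (2 + M) p (suc M)
        from (inj₁ refl) = inj₂ (inj₂ (refl , refl))
        from (inj₂ refl) = inj₁ (inj₁ refl)

      path-adj⇔ : ∀ {p q} → p ≤ M → q ≤ M → Adj G (g p) (g q) ⇔ CycAdjMod (2 + M) p q
      path-adj⇔ {p} {q} p≤M q≤M = mk⇔ to from
        where
        to : Adj G (g p) (g q) → CycAdjMod (2 + M) p q
        to p∼q with <-cmp p q
        ... | tri< p<q _ _ = inj₁ (inj₁ (sym (proj₂ (chordless π p q p<q q≤M) p∼q)))
        ... | tri≈ _ refl _ = contradiction refl (Adj⇒≢ p∼q)
        ... | tri> _ _ q<p = inj₂ (inj₁ (sym (proj₂ (chordless π q p q<p p≤M) (Adj-sym p∼q))))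
        from : CycAdjMod (2 + M) p q → Adj G (g p) (g q)
        from (inj₁ (inj₁ refl))     = isWalk π p q≤M
        from (inj₁ (inj₂ (1+p≡ , _))) = contradiction 1+p≡ (not-last p≤M)
        from (inj₂ (inj₁ refl))     = Adj-sym (isWalk π q p≤M)
        from (inj₂ (inj₂ (1+q≡ , _))) = contradiction 1+q≡ (not-last q≤M)

      adj⇔ : ∀ {p q} → View p → View q → Adj G (cycle p) (cycle q) ⇔ CycAdjMod (2 + M) p q
      adj⇔ (path p≤M) (path q≤M) rewrite cycle-path p≤M | cycle-path q≤M = path-adj⇔ p≤M q≤M
      adj⇔ (path p≤M) apex rewrite cycle-path p≤M | cycle-apex = mk⇔
        (λ p∼x → Equivalence.from (apex-cyc⇔ p≤M) (Equivalence.to (x∼g p≤M) (Adj-sym p∼x)))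
        (λ c → Adj-sym (Equivalence.from (x∼g p≤M) (Equivalence.to (apex-cyc⇔ p≤M) c)))
      adj⇔ apex (path q≤M) rewrite cycle-path q≤M | cycle-apex = mk⇔
        (λ x∼q → swap (Equivalence.from (apex-cyc⇔ q≤M) (Equivalence.to (x∼g q≤M) x∼q)))
        (λ c → Equivalence.from (x∼g q≤M) (Equivalence.to (apex-cyc⇔ q≤M) (swap c)))
      adj⇔ apex apex rewrite cycle-apex = mk⇔ (λ x∼x → contradiction refl (Adj⇒≢ x∼x)) λ
        { (inj₁ (inj₁ 2+M≡1+M)) → contradiction 2+M≡1+M (1+n≢n)
        ; (inj₂ (inj₁ 2+M≡1+M)) → contradiction 2+M≡1+M (1+n≢n) }

      cycle-injective : ∀ {i j} → cycle (toℕ i) ≡ cycle (toℕ j) → i ≡ j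
      cycle-injective {i} {j} c≡c = toℕ-injective (view-injective (view (toℕ<n i)) (view (toℕ<n j)) c≡c)
        where
        view-injective : ∀ {p q} → View p → View q → cycle p ≡ cycle q → p ≡ q
        view-injective {p} {q} (path p≤M) (path q≤M) c≡c rewrite cycle-path p≤M | cycle-path q≤M with <-cmp p q
        ... | tri< p<q _ _ = contradiction c≡c (proj₁ (chordless π _ _ p<q q≤M))
        ... | tri≈ _ p≡q _ = p≡q
        ... | tri> _ _ q<p = contradiction (sym c≡c) (proj₁ (chordless π _ _ q<p p≤M))
        view-injective (path p≤M) apex c≡c rewrite cycle-path p≤M | cycle-apex = contradiction c≡c (g≢x p≤M)
        view-injective apex (path q≤M) c≡c rewrite cycle-path q≤M | cycle-apex = contradiction (sym c≡c) (g≢x q≤M)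
        view-injective apex apex _ = refl

    induced-path+apex⇒cycle : InducedCycle G (2 + len π)
    induced-path+apex⇒cycle =
      (λ i → cycle (toℕ i)) , cycle-injective , λ i j → adj⇔ (view (toℕ<n i)) (view (toℕ<n j))

  Detour : Fin m → Fin m → Fin m → Pred (Fin m) 0ℓ
  Detour x a b v = v ≡ a ⊎ v ≡ b ⊎ Far x v

  module _ (chordal : Chordal G) where

    induced-no-detour : Adj G x a → Adj G x b → ¬ Adj G a b → a ≢ b → ¬ InducedPath (Detour x a b) a b
    induced-no-detour {x} x∼a x∼b a≁b a≢b π with 2 ≤? len π
    ... | yes 2≤L = chordal (2 + len π) (s≤s (s≤s 2≤L))
                      (induced-path+apex⇒cycle π x∼a x∼b interior-far)
      where
      interior-far : ∀ j → 0 < j → j < len π → Far x (vertex π j)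
      interior-far j 0<j j<L with within π j (<⇒≤ j<L)
      ... | inj₁ πⱼ≡a =
        contradiction (trans (vertex-0 π) (sym πⱼ≡a)) (proj₁ (chordless π 0 j 0<j (<⇒≤ j<L)))
      ... | inj₂ (inj₁ πⱼ≡b) =
        contradiction (trans πⱼ≡b (sym (vertex-len π))) (proj₁ (chordless π j (len π) j<L ≤-refl))
      ... | inj₂ (inj₂ far) = far
    ... | no 2≰L with m≤n⇒m<n∨m≡n (≤-pred (≰⇒> 2≰L))
    ...   | inj₁ L<1 =
      a≢b (trans (sym (vertex-0 π)) (trans (cong (vertex π) (sym (n<1⇒n≡0 L<1))) (vertex-len π)))
    ...   | inj₂ L≡1 = a≁b (subst₂ (Adj G) (vertex-0 π) (trans (cong (vertex π) (sym L≡1)) (vertex-len π))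
                                 (isWalk π 0 (subst (0 <_) (sym L≡1) (s≤s z≤n))))

    no-detour : Adj G x a → Adj G x b → ¬ Adj G a b → a ≢ b → ¬ Walk (Detour x a b) a b
    no-detour x∼a x∼b a≁b a≢b xs = induced-no-detour x∼a x∼b a≁b a≢b (walk⇒induced-path xs)

    module _ {A S : Subset m} (A-connected : Connected A) (S-clique : IsClique G S)
             (S∉A : ∀ {s} → s ∈ S → s ∉ A) (S-attached : ∀ {s} → s ∈ S → ∃ λ a → a ∈ A × Adj G a s) where

      private
        -- w is the first vertex adjacent to s on a walk in A from v. If t ∈ S were adjacent to v
        -- but not to w, the walk from the last neighbour of t before w, continued by s, would be
        -- a detour around t.
        complete-step : ∀ {v s} → v ∈ A → s ∈ S → ¬ Adj G v s →
          ∃ λ w → w ∈ A × Adj G w s × (∀ {t} → t ∈ S → Adj G v t → Adj G w t)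
        complete-step {v} {s} v∈A s∈S v≁s with S-attached s∈S
        ... | a , a∈A , a∼s with first-hit (λ y → Adj? y s) (A-connected v∈A a∈A) a∼s
        ... | w , w∼s , w∈A , v⇝w = w , w∈A , w∼s , transfer
          where
          transfer : ∀ {t} → t ∈ S → Adj G v t → Adj G w t
          transfer {t} t∈S v∼t with Adj? w t
          ... | yes w∼t = w∼t
          ... | no  w≁t with last-hit (Adj? t) v⇝w (Adj-sym v∼t)
          ...   | u , t∼u , inj₁ refl , _ = contradiction (Adj-sym t∼u) w≁t
          ...   | u , t∼u , inj₂ (u∈A , u≁s) , u⇝w =
            ⊥-elim (no-detour t∼u t∼s u≁s (λ { refl → S∉A s∈S u∈A })
              (Walk-map to-detour u⇝w ∷ʳ⟨ w∼s ⟩ inj₂ (inj₁ refl)))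
            where
            t∼s : Adj G t s
            t∼s = S-clique t s t∈S s∈S λ { refl → v≁s v∼t }
            ∈A⇒≢t : ∀ {y} → y ∈ A → y ≢ t
            ∈A⇒≢t y∈A refl = S∉A t∈S y∈A
            to-detour : ∀ {y} → y ≡ u ⊎ ((y ≡ w ⊎ (y ∈ A × ¬ Adj G y s)) × ¬ Adj G t y) → Detour t u s y
            to-detour (inj₁ y≡u)                     = inj₁ y≡u
            to-detour (inj₂ (inj₁ refl , t≁y))       = inj₂ (inj₂ (∈A⇒≢t w∈A , t≁y))
            to-detour (inj₂ (inj₂ (y∈A , _) , t≁y)) = inj₂ (inj₂ (∈A⇒≢t y∈A , t≁y))

        complete-from : ∀ {v} → v ∈ A → Acc _⊃_ (S ∩ neighbours v) → ∃ λ w → w ∈ A × (∀ {s} → s ∈ S → Adj G w s)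
        complete-from {v} v∈A (acc rec) with any? (λ s → s ∈? S ×-dec ¬? (Adj? v s))
        ... | no none = v , v∈A , λ {s} s∈S → decidable-stable (Adj? v s) (λ v≁s → none (s , s∈S , v≁s))
        ... | yes (s , s∈S , v≁s) with complete-step v∈A s∈S v≁s
        ...   | w , w∈A , w∼s , v⊆w = complete-from w∈A (rec (Sv⊆Sw , s , s∈Sw , s∉Sv))
          where
          Sv⊆Sw : S ∩ neighbours v ⊆ S ∩ neighbours w
          Sv⊆Sw t∈Sv = let (t∈S , t∈Nv) = x∈p∩q⁻ S _ t∈Sv
                       in x∈p∩q⁺ (t∈S , ∈-select⁺ (Adj? w) (v⊆w t∈S (∈-select⁻ (Adj? v) t∈Nv)))
          s∈Sw : s ∈ S ∩ neighbours w
          s∈Sw = x∈p∩q⁺ (s∈S , ∈-select⁺ (Adj? w) w∼s)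
          s∉Sv : s ∉ S ∩ neighbours v
          s∉Sv s∈Sv = v≁s (∈-select⁻ (Adj? v) (proj₂ (x∈p∩q⁻ S _ s∈Sv)))

      complete-vertex : ∀ {v} → v ∈ A → ∃ λ w → w ∈ A × (∀ {s} → s ∈ S → Adj G w s)
      complete-vertex v∈A = complete-from v∈A (⊃-wellFounded _)

    module _ {W : Subset m} {θ M : ℕ} (θ≤M : θ ≤ M) where

      module HubRemoval {A : Subset m} (A⊆W : A ⊆ W) (A-connected : Connected A) (M<∣A∣ : M < ∣ A ∣)
                        (N-clique : IsClique G (neighbourhood W A)) where

        private
          N : Subset m
          N = neighbourhood W A

          complete : ∃ λ h → h ∈ A × (∀ {s} → s ∈ N → Adj G h s)
          complete = complete-vertex A-connected N-clique (λ s∈N → proj₁ (proj₂ (∈-neighbourhood⁻ s∈N)))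
            (λ s∈N → proj₂ (proj₂ (∈-neighbourhood⁻ s∈N))) (proj₂ (∣p∣>0⇒Nonempty (≤-<-trans z≤n M<∣A∣)))

        hub : Fin m
        hub = proj₁ complete

        hub∈A : hub ∈ A
        hub∈A = proj₁ (proj₂ complete)

        C : Subset m
        C = N ∪ ⁅ hub ⁆

        C-clique : IsClique G C
        C-clique = IsClique-∪⁅⁆ N-clique (proj₂ (proj₂ complete))

        C⊆W : C ⊆ W
        C⊆W y∈C with x∈p∪q⁻ N ⁅ hub ⁆ y∈C
        ... | inj₁ y∈N = proj₁ (∈-neighbourhood⁻ y∈N)
        ... | inj₂ y∈hub rewrite x∈⁅y⁆⇒x≡y hub y∈hub = A⊆W hub∈A

        θ≤∣A-hub∣ : θ ≤ ∣ A - hub ∣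
        θ≤∣A-hub∣ = ≤-trans θ≤M (≤-pred (≤-trans M<∣A∣
          (subst (λ k → ∣ A ∣ ≤ k + ∣ A - hub ∣) (∣⁅x⁆∣≡1 hub) (∣p∣≤∣q∣+∣p─q∣ A ⁅ hub ⁆))))

        A-hub⊆A : A - hub ⊆ A
        A-hub⊆A = p─q⊆p A ⁅ hub ⁆

        A-hub∉C : y ∈ A - hub → y ∉ C
        A-hub∉C y∈A-hub y∈C with x∈p∪q⁻ N ⁅ hub ⁆ y∈C
        ... | inj₁ y∈N   = proj₁ (proj₂ (∈-neighbourhood⁻ y∈N)) (A-hub⊆A y∈A-hub)
        ... | inj₂ y∈hub = x∈p─q⇒x∉q A ⁅ hub ⁆ y∈A-hub y∈hub

        attached⇒∈A-hub : y ∈ W → y ∉ C → x ∈ A → Adj G x y → y ∈ A - hub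
        attached⇒∈A-hub {y} {x} y∈W y∉C x∈A x∼y with y ∈? A
        ... | yes y∈A = x∈p∧x≢y⇒x∈p-y y∈A λ { refl → y∉C (q⊆p∪q N ⁅ hub ⁆ (x∈⁅x⁆ hub)) }
        ... | no  y∉A = contradiction (p⊆p∪q ⁅ hub ⁆ (∈-neighbourhood⁺ (y∈W , y∉A , x , x∈A , x∼y))) y∉C

        chunk⇒separation : Chunk (A - hub) θ M → Separation W θ M
        chunk⇒separation X = record
          { C        = C
          ; X        = X.set
          ; C-clique = C-clique
          ; C⊆W      = C⊆W
          ; X⊆W─C    = λ x∈X → x∈p∧x∉q⇒x∈p─q (A⊆W (A-hub⊆A (X.⊆U x∈X))) (A-hub∉C (X.⊆U x∈X))
          ; X-closed = λ x∈X y∈W─C x∼y → X.closed x∈X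
              (attached⇒∈A-hub (p─q⊆p W C y∈W─C) (x∈p─q⇒x∉q W C y∈W─C) (A-hub⊆A (X.⊆U x∈X)) x∼y) x∼y
          ; lower    = X.lower
          ; upper    = X.upper
          }
          where module X = Chunk X

        module _ (K : Component (A - hub)) where

          private module K = Component K

          component⊂A : K.set ⊂ A
          component⊂A = A-hub⊆A ∘ K.⊆U , hub , hub∈A , λ hub∈K → x∈p─q⇒x∉q A ⁅ hub ⁆ (K.⊆U hub∈K) (x∈⁅x⁆ hub)

          component-neighbourhood-clique : IsClique G (neighbourhood W K.set)
          component-neighbourhood-clique = IsClique-⊆ NK⊆C C-clique
            where
            NK⊆C : neighbourhood W K.set ⊆ C
            NK⊆C {y} y∈NK with ∈-neighbourhood⁻ y∈NK
            ... | y∈W , y∉K , x , x∈K , x∼y = decidable-stable (y ∈? C)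
                    λ y∉C → y∉K (K.closed x∈K (attached⇒∈A-hub y∈W y∉C (A-hub⊆A (K.⊆U x∈K)) x∼y) x∼y)

      separate-large : ∀ A → Acc _⊂_ A → A ⊆ W → Connected A → M < ∣ A ∣ →
        IsClique G (neighbourhood W A) → Separation W θ M
      separate-large A (acc rec) A⊆W A-connected M<∣A∣ N-clique =
        [ chunk⇒separation , recurse ]′ (chunk-or-large-component (A - hub) θ M θ≤∣A-hub∣)
        where
        open HubRemoval A⊆W A-connected M<∣A∣ N-clique

        recurse : LargeComponent (A - hub) M → Separation W θ M
        recurse (K , M<∣K∣) = separate-large K.set (rec (component⊂A K)) (A⊆W ∘ proj₁ (component⊂A K))
                                K.connected M<∣K∣ (component-neighbourhood-clique K)
          where module K = Component K

      separate : θ ≤ ∣ W ∣ → Separation W θ M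
      separate θ≤∣W∣ with chunk-or-large-component W θ M θ≤∣W∣
      ... | inj₁ X = record
        { C        = ⊥
        ; X        = X.set
        ; C-clique = IsClique-⊥
        ; C⊆W      = ⊥⊆
        ; X⊆W─C    = subst (X.set ⊆_) (sym (p─⊥≡p W)) X.⊆U
        ; X-closed = subst (Closed X.set) (sym (p─⊥≡p W)) X.closed
        ; lower    = X.lower
        ; upper    = X.upper
        }
        where module X = Chunk X
      ... | inj₂ (K , M<∣K∣) = separate-large K.set (⊂-wellFounded _) K.⊆U K.connected M<∣K∣ no-neighbours
        where
        module K = Component K
        no-neighbours : IsClique G (neighbourhood W K.set)
        no-neighbours u _ u∈N = let (u∈W , u∉K , x , x∈K , x∼u) = ∈-neighbourhood⁻ u∈N
                                in contradiction (K.closed x∈K u∈W x∼u) u∉K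

  ApartTriple : Subset m → ℕ → Subset m → Subset m → Subset m → Set
  ApartTriple Z k X₁ X₂ X₃ =
    AvoidsSet X₁ Z × AvoidsSet X₂ Z × AvoidsSet X₃ Z ×
    Disjoint X₁ X₂ × Disjoint X₁ X₃ × Disjoint X₂ X₃ ×
    Anticomplete G X₁ X₂ × Anticomplete G X₁ X₃ × Anticomplete G X₂ X₃ ×
    ∣ X₁ ∣ ≡ k × ∣ X₂ ∣ ≡ k × ∣ X₃ ∣ ≡ k

  module _ {W θ M θ′ M′} (S₁ : Separation W θ M) (S₂ : Separation (Separation.Y S₁) θ′ M′) where

    private
      module S₁ = Separation S₁
      module S₂ = Separation S₂

    nested-separations-apart : ∀ {k} → k ≤ ∣ S₁.X ∣ → k ≤ ∣ S₂.X ∣ → k ≤ ∣ S₂.Y ∣ →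
      Σ (Subset m) λ P₁ → Σ (Subset m) λ P₂ → Σ (Subset m) λ P₃ → ApartTriple (S₁.C ∪ S₂.C) k P₁ P₂ P₃
    nested-separations-apart k≤X₁ k≤X₂ k≤Y₂
      with ∃-subset-of-size S₁.X k≤X₁ | ∃-subset-of-size S₂.X k≤X₂ | ∃-subset-of-size S₂.Y k≤Y₂
    ... | P₁ , P₁⊆ , ∣P₁∣≡k | P₂ , P₂⊆ , ∣P₂∣≡k | P₃ , P₃⊆ , ∣P₃∣≡k = P₁ , P₂ , P₃ ,
      (λ _ v∈ → ∉∪ (S₁.X∉C (P₁⊆ v∈)) λ v∈C₂ → S₁.Y∉X (S₂.C⊆W v∈C₂) (P₁⊆ v∈)) ,
      (λ _ v∈ → ∉∪ (S₁.Y∉C (S₂.X⊆W (P₂⊆ v∈))) (S₂.X∉C (P₂⊆ v∈))) ,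
      (λ _ v∈ → ∉∪ (S₁.Y∉C (S₂.Y⊆W (P₃⊆ v∈))) (S₂.Y∉C (P₃⊆ v∈))) ,
      (λ _ v∈₁ v∈₂ → S₁.Y∉X (S₂.X⊆W (P₂⊆ v∈₂)) (P₁⊆ v∈₁)) ,
      (λ _ v∈₁ v∈₃ → S₁.Y∉X (S₂.Y⊆W (P₃⊆ v∈₃)) (P₁⊆ v∈₁)) ,
      (λ _ v∈₂ v∈₃ → S₂.Y∉X (P₃⊆ v∈₃) (P₂⊆ v∈₂)) ,
      (λ u v u∈ v∈ → S₁.X-Y-anticomplete u v (P₁⊆ u∈) (S₂.X⊆W (P₂⊆ v∈))) ,
      (λ u v u∈ v∈ → S₁.X-Y-anticomplete u v (P₁⊆ u∈) (S₂.Y⊆W (P₃⊆ v∈))) ,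
      (λ u v u∈ v∈ → S₂.X-Y-anticomplete u v (P₂⊆ u∈) (P₃⊆ v∈)) ,
      ∣P₁∣≡k , ∣P₂∣≡k , ∣P₃∣≡k
      where
      ∉∪ : ∀ {v A B} → v ∉ A → v ∉ B → v ∉ A ∪ B
      ∉∪ {A = A} {B} v∉A v∉B v∈ with x∈p∪q⁻ A B v∈
      ... | inj₁ v∈A = v∉A v∈A
      ... | inj₂ v∈B = v∉B v∈B

-- Multiplied by 17d, the claim reduces to 51n + 80d ≤ 12dn, which holds as d < n and 100 ≤ d.
clique-budget : ∀ {n m a b c d} .{{_ : NonZero d}} → 100 ≤ d → d < n → m * d + n ≡ n * d →
  a * d < n → b * d < n → 17 * c ≤ n + 16 → a + b + 5 * c ≤ m
clique-budget {n} {m} {a} {b} {c} {d} 100≤d d<n order ad<n bd<n 17c≤ =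
  *-cancelʳ-≤ (a + b + 5 * c) m (17 * d) {{m*n≢0 17 d}} (+-cancelʳ-≤ (17 * n) _ _ (begin
    (a + b + 5 * c) * (17 * d) + 17 * n                       ≡⟨ expand a b c d n ⟩
    17 * (a * d) + 17 * (b * d) + 5 * d * (17 * c) + 17 * n   ≤⟨ +-monoˡ-≤ (17 * n) terms≤ ⟩
    17 * n + 17 * n + 5 * d * (n + 16) + 17 * n               ≡⟨ collect n d ⟩
    51 * n + 80 * d + 5 * d * n                               ≤⟨ +-monoˡ-≤ (5 * d * n) linear≤quadratic ⟩
    12 * (d * n) + 5 * d * n                                  ≡⟨ regroup n d ⟩
    17 * (n * d)                                              ≡⟨ cong (17 *_) order ⟨
    17 * (m * d + n)                                          ≡⟨ distribute m d n ⟩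
    m * (17 * d) + 17 * n                                     ∎))
  where
  open ≤-Reasoning

  terms≤ : 17 * (a * d) + 17 * (b * d) + 5 * d * (17 * c) ≤ 17 * n + 17 * n + 5 * d * (n + 16)
  terms≤ = +-mono-≤ (+-mono-≤ (*-monoʳ-≤ 17 (<⇒≤ ad<n)) (*-monoʳ-≤ 17 (<⇒≤ bd<n))) (*-monoʳ-≤ (5 * d) 17c≤)

  linear≤quadratic : 51 * n + 80 * d ≤ 12 * (d * n)
  linear≤quadratic = begin
    51 * n + 80 * d   ≤⟨ +-monoʳ-≤ (51 * n) (*-monoʳ-≤ 80 (<⇒≤ d<n)) ⟩
    51 * n + 80 * n   ≡⟨ *-distribʳ-+ n 51 80 ⟨
    131 * n           ≤⟨ *-monoˡ-≤ n (≤ᵇ⇒≤ 131 1200 _) ⟩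
    1200 * n          ≡⟨ *-assoc 12 100 n ⟩
    12 * (100 * n)    ≤⟨ *-monoʳ-≤ 12 (*-monoˡ-≤ n 100≤d) ⟩
    12 * (d * n)      ∎

  expand : ∀ a b c d n →
    (a + b + 5 * c) * (17 * d) + 17 * n ≡ 17 * (a * d) + 17 * (b * d) + 5 * d * (17 * c) + 17 * n
  expand = solve-∀

  collect : ∀ n d → 17 * n + 17 * n + 5 * d * (n + 16) + 17 * n ≡ 51 * n + 80 * d + 5 * d * n
  collect = solve-∀

  regroup : ∀ n d → 12 * (d * n) + 5 * d * n ≡ 17 * (n * d)
  regroup = solve-∀

  distribute : ∀ m d n → 17 * (m * d + n) ≡ m * (17 * d) + 17 * n
  distribute = solve-∀

cliques-fit : ∀ {n m} (G : Graph m) → m * D ≡ n * D ∸ n → (∀ C → IsClique G C → ∣ C ∣ * D < n) →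
  ∀ {C C′} → IsClique G C → IsClique G C′ → ∣ C ∣ + ∣ C′ ∣ + 5 * ceil17 n ≤ m
cliques-fit {n} {m} G eq small {C} {C′} C-clique C′-clique =
  clique-budget {a = ∣ C ∣} {∣ C′ ∣} {ceil17 n} (≤ᵇ⇒≤ 100 D _) D<n order
    (small _ C-clique) (small _ C′-clique) 17c≤n+16
  where
  0<n : 0 < n
  0<n = subst (λ k → k * D < n) (∣⊥∣≡0 m) (small ⊥ (IsClique-⊥ G))

  order : m * D + n ≡ n * D
  order = trans (cong (_+ n) eq) (m∸n+n≡m (m≤m*n n D))

  0<m : 0 < m
  0<m = n≢0⇒n>0 λ m≡0 →
    <⇒≢ (m<m*n n D {{>-nonZero 0<n}} (≤ᵇ⇒≤ 2 D _)) (subst (λ k → k * D + n ≡ n * D) m≡0 order)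

  D<n : D < n
  D<n = subst (λ k → k * D < n) (∣⁅x⁆∣≡1 (fromℕ< 0<m)) (small _ (IsClique-⁅⁆ G {fromℕ< 0<m}))

  17c≤n+16 : 17 * ceil17 n ≤ n + 16
  17c≤n+16 = subst (_≤ n + 16) (*-comm (ceil17 n) 17) (m/n*n≤m (n + 16) 17)

lemma10p4 : (n m : ℕ) → m * D ≡ n * D ∸ n → (G : Graph m) → Chordal G →
    (∀ (C : Subset m) → IsClique G C → ∣ C ∣ * D < n) →
    Σ (Subset m) λ Z → κ≤ G Z 2 ×
      Σ (Subset m) λ X₁ → Σ (Subset m) λ X₂ → Σ (Subset m) λ X₃ →
        AvoidsSet X₁ Z × AvoidsSet X₂ Z × AvoidsSet X₃ Z ×
        Disjoint X₁ X₂ × Disjoint X₁ X₃ × Disjoint X₂ X₃ ×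
        Anticomplete G X₁ X₂ × Anticomplete G X₁ X₃ × Anticomplete G X₂ X₃ ×
        ∣ X₁ ∣ ≡ ceil17 n × ∣ X₂ ∣ ≡ ceil17 n × ∣ X₃ ∣ ≡ ceil17 n
lemma10p4 n m eq G chordal small =
  S₁.C ∪ S₂.C , κ≤-∪ G S₁.C-clique S₂.C-clique , nested-separations-apart G S₁ S₂ S₁.lower S₂.lower c≤∣Y₂∣
  where
  c : ℕ
  c = ceil17 n

  fit : ∀ {C C′} → IsClique G C → IsClique G C′ → ∣ C ∣ + ∣ C′ ∣ + 5 * c ≤ m
  fit = cliques-fit G eq small

  ∅ V : Subset m
  ∅ = ⊥
  V = ⊤

  c≤∣V∣ : c ≤ ∣ V ∣
  c≤∣V∣ = subst (c ≤_) (sym (∣⊤∣≡n m)) (m+n≤o⇒m≤o c (m+n≤o⇒n≤o (∣ ∅ ∣ + ∣ ∅ ∣) (fit (IsClique-⊥ G) (IsClique-⊥ G))))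

  S₁ : Separation G V c c
  S₁ = separate G chordal ≤-refl c≤∣V∣
  module S₁ = Separation S₁

  Y₁-large : ∀ {C} → IsClique G C → ∣ C ∣ + 3 * c ≤ ∣ S₁.Y ∣
  Y₁-large {C} C-clique =
    S₁.∣Y∣-lower (subst₂ _≤_ (regroup ∣ S₁.C ∣ ∣ C ∣ c) (sym (∣⊤∣≡n m)) (fit S₁.C-clique C-clique))
    where
    regroup : ∀ a b c → a + b + 5 * c ≡ a + (c + c) + (b + 3 * c)
    regroup = solve-∀

  S₂ : Separation G S₁.Y c c
  S₂ = separate G chordal ≤-refl (m+n≤o⇒m≤o c (m+n≤o⇒n≤o ∣ ∅ ∣ (Y₁-large (IsClique-⊥ G))))
  module S₂ = Separation S₂

  c≤∣Y₂∣ : c ≤ ∣ S₂.Y ∣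
  c≤∣Y₂∣ = S₂.∣Y∣-lower (subst (_≤ ∣ S₁.Y ∣) (regroup ∣ S₂.C ∣ c) (Y₁-large S₂.C-clique))
    where
    regroup : ∀ a c → a + 3 * c ≡ a + (c + c) + c
    regroup = solve-∀
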